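{- Let $d$ be a $\sigma$-ary De Bruijn cycle of order $k$, written as a linear string of length $\sigma^k$, and let $s\in d^*$ (a concatenation of copies of $d$) have length $n$. Then $nH_k^*(s)=O(\sigma^k\log n)$.
   Context: A $\sigma$-ary De Bruijn cycle of order $k$ is a cyclic sequence over an alphabet of size $\sigma$ in which every possible $k$-tuple appears exactly once (as a cyclically contiguous block). Logarithms are base 2. For a string $x$, $H_0(x)=\frac1{|x|}\sum_a \mathrm{occ}(a,x)\log\frac{|x|}{\mathrm{occ}(a,x)}$; $H_0^*(x)=0$ if $|x|=0$, $H_0^*(x)=(1+\lfloor\log|x|\rfloor)/|x|$ if $x$ is nonempty and unary, and $H_0^*(x)=H_0(x)$ otherwise. The $k$th-order modified empirical entropy is $H_k^*(s)=\frac1n\sum_{|w|=k}|w_s|H_0^*(w_s)$, where $w_s$ is the concatenation of the characters immediately following occurrences of the $k$-tuple $w$ in $s$. -}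

module Defs where

open import Data.Nat using (ℕ; zero; suc; _+_; _*_; _^_; _≤_; NonZero)
open import Data.Nat.Properties using (m^n≢0)
open import Data.Nat.DivMod using (_mod_)
open import Data.Nat.Logarithm using (⌊log₂_⌋)
open import Data.Fin using (Fin; toℕ)
import Data.Fin as Fin
open import Data.List using (List; []; _∷_; length; filter; take; drop; map; concat; replicate; allFin; cartesianProductWith)
import Data.List.Properties as LP
open import Data.List.Relation.Unary.All using (All)
open import Data.List.Relation.Unary.All using () renaming (all? to all?)
open import Data.Vec using (Vec)
import Data.Vec.Properties as VP
open import Data.Nat.ListAction using (product)
import Data.Vec.Functional as VF
open import Data.Product using (Σ; ∃; _×_)
open import Relation.Nullary using (yes; no)
open import Relation.Binary.PropositionalEquality using (_≡_)

Str : ℕ → Set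
Str σ = List (Fin σ)

Cyc : (σ k : ℕ) → .{{_ : NonZero σ}} → Set
Cyc σ k = VF.Vector (Fin σ) (σ ^ k)

window : (σ k : ℕ) → .{{_ : NonZero σ}} → Cyc σ k → Fin (σ ^ k) → Vec (Fin σ) k
window σ k d i = Data.Vec.tabulate (λ j → d (_mod_ (toℕ i + toℕ j) (σ ^ k) {{m^n≢0 σ k}}))

occCyc : (σ k : ℕ) → .{{_ : NonZero σ}} → Cyc σ k → Vec (Fin σ) k → ℕ
occCyc σ k d w = length (filter (λ i → VP.≡-dec Fin._≟_ (window σ k d i) w) (allFin (σ ^ k)))

IsDeBruijn : (σ k : ℕ) → .{{_ : NonZero σ}} → Cyc σ k → Set
IsDeBruijn σ k d = (w : Vec (Fin σ) k) → occCyc σ k d w ≡ 1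

linear : (σ k : ℕ) → .{{_ : NonZero σ}} → Cyc σ k → Str σ
linear σ k d = VF.toList d

InStar : ∀ {σ} → Str σ → Str σ → Set
InStar s x = ∃ λ m → s ≡ concat (replicate m x)

tuples : (σ k : ℕ) → List (Str σ)
tuples σ zero = [] ∷ []
tuples σ (suc k) = cartesianProductWith _∷_ (allFin σ) (tuples σ k)

-- w_s : the characters immediately following occurrences of w in s
-- (w assumed to have length k).
ctx : ∀ {σ} → (k : ℕ) → Str σ → Str σ → Str σ
ctx k w [] = []
ctx k w (a ∷ xs) with drop k (a ∷ xs)
... | [] = ctx k w xs
... | c ∷ _ with LP.≡-dec Fin._≟_ (take k (a ∷ xs)) w
...   | yes _ = c ∷ ctx k w xs
...   | no _  = ctx k w xs

occ : ∀ {σ} → Fin σ → Str σ → ℕ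
occ a x = length (filter (λ b → b Fin.≟ a) x)

-- Exact encoding of 2^{|x| H_0^*(x)} as a fraction  num / den  of naturals:
--  * |x| = 0        : 2^0 = 1/1
--  * x unary        : 2^{1 + ⌊log |x|⌋} / 1
--  * otherwise      : 2^{Σ_a occ log(|x|/occ)} = |x|^{|x|} / Π_a occ(a,x)^{occ(a,x)}
H0*num : ∀ {σ} → Str σ → ℕ
H0*num [] = 1
H0*num {σ} (a ∷ xs) with all? (λ b → b Fin.≟ a) xs
... | yes _ = 2 ^ (1 + ⌊log₂ length (a ∷ xs) ⌋)
... | no _  = length (a ∷ xs) ^ length (a ∷ xs)

H0*den : ∀ {σ} → Str σ → ℕ
H0*den [] = 1
H0*den {σ} (a ∷ xs) with all? (λ b → b Fin.≟ a) xs
... | yes _ = 1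
... | no _  = product (map (λ b → occ b (a ∷ xs) ^ occ b (a ∷ xs)) (allFin σ))

-- 2^{n H_k^*(s)} = Π_{|w|=k} 2^{|w_s| H_0^*(w_s)} = Hk*num / Hk*den
Hk*num : (σ k : ℕ) → Str σ → ℕ
Hk*num σ k s = product (map (λ w → H0*num (ctx k w s)) (tuples σ k))

Hk*den : (σ k : ℕ) → Str σ → ℕ
Hk*den σ k s = product (map (λ w → H0*den (ctx k w s)) (tuples σ k))

-- Write N = σ^k and let f j = d (j mod N) be the periodic extension of d, so that
-- every s ∈ d^* is the prefix f 0, …, f (n ∸ 1).  Each k-tuple occurs in d at a single
-- cyclic position, so two occurrences of a k-tuple w in s start at positions that agree
-- modulo N and are followed by the same character: every context w_s is unary.  Hence
-- 2^{|w_s| H₀*(w_s)} = 2^{1 + ⌊log |w_s|⌋} ≤ 2n ≤ n² for each of the σ^k tuples w, and the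
-- denominators are all 1, which gives 2^{n H_k*(s)} ≤ n^{2σ^k}.
module Submission where

open import Defs
open import Data.Nat using (ℕ; zero; suc; _+_; _*_; _∸_; _^_; _≤_; _<_; z≤n; s≤s; NonZero; ⌊_/2⌋; ⌈_/2⌉)
open import Data.Nat.Properties
open import Data.Nat.DivMod using (_mod_; _%_; %-distribˡ-+; m%n%n≡m%n; [m+n]%n≡m%n; m<n⇒m%n≡m)
open import Data.Nat.Induction using (<-rec)
open import Data.Nat.Logarithm using (⌊log₂_⌋; ⌊log₂⌋-mono-≤; ⌊log₂⌊n/2⌋⌋≡⌊log₂n⌋∸1)
open import Data.Nat.ListAction using (product)
open import Data.Fin using (Fin; toℕ)
import Data.Fin as Fin
import Data.Fin.Properties as FP
open import Data.List using (List; []; _∷_; _++_; length; take; drop; map; concat; replicate; allFin; cartesianProductWith; tabulate)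
import Data.List.Properties as LP
open import Data.List.Membership.Propositional using (_∈_)
open import Data.List.Membership.Propositional.Properties using (∈-filter⁺; ∈-allFin)
open import Data.List.Relation.Unary.Any using (here; there)
import Data.List.Relation.Unary.All as All
import Data.Vec as V
import Data.Vec.Properties as VP
open import Data.Product using (Σ; ∃; _×_; _,_)
open import Data.Empty using (⊥-elim)
open import Relation.Nullary using (Dec; yes; no)
open import Relation.Binary.PropositionalEquality

2^⌊log₂n⌋≤n : ∀ n → 0 < n → 2 ^ ⌊log₂ n ⌋ ≤ n
2^⌊log₂n⌋≤n = <-rec _ step
  where
  step : ∀ n → (∀ {m} → m < n → 0 < m → 2 ^ ⌊log₂ m ⌋ ≤ m) → 0 < n → 2 ^ ⌊log₂ n ⌋ ≤ n
  step (suc zero) _ _ = ≤-refl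
  step n@(suc (suc m)) rec _ = begin
    2 ^ ⌊log₂ n ⌋          ≡⟨ cong (2 ^_) ⌊log₂n⌋≡1+⌊log₂h⌋ ⟩
    2 * 2 ^ ⌊log₂ h ⌋      ≤⟨ *-monoʳ-≤ 2 (rec (⌊n/2⌋<n (suc m)) (s≤s z≤n)) ⟩
    h + (h + 0)            ≤⟨ +-monoʳ-≤ h (≤-trans (≤-reflexive (+-identityʳ h)) (⌊n/2⌋≤⌈n/2⌉ n)) ⟩
    h + ⌈ n /2⌉            ≡⟨ ⌊n/2⌋+⌈n/2⌉≡n n ⟩
    n                      ∎
    where
    open ≤-Reasoning
    h : ℕ
    h = ⌊ n /2⌋
    ⌊log₂n⌋≡1+⌊log₂h⌋ : ⌊log₂ n ⌋ ≡ suc ⌊log₂ h ⌋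
    ⌊log₂n⌋≡1+⌊log₂h⌋ = trans (sym (m+[n∸m]≡n (⌊log₂⌋-mono-≤ {2} {n} (s≤s (s≤s z≤n)))))
                              (cong suc (sym (⌊log₂⌊n/2⌋⌋≡⌊log₂n⌋∸1 n)))

product-map-≤ : ∀ {A : Set} (g : A → ℕ) {B} (xs : List A) → (∀ x → g x ≤ B) →
  product (map g xs) ≤ B ^ length xs
product-map-≤ g [] g≤B = ≤-refl
product-map-≤ g (x ∷ xs) g≤B = *-mono-≤ (g≤B x) (product-map-≤ g xs g≤B)

product-map-≡1 : ∀ {A : Set} (g : A → ℕ) (xs : List A) → (∀ x → g x ≡ 1) → product (map g xs) ≡ 1
product-map-≡1 g [] g≡1 = refl
product-map-≡1 g (x ∷ xs) g≡1 = cong₂ _*_ (g≡1 x) (product-map-≡1 g xs g≡1)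

length-cartesianProductWith : ∀ {A B C : Set} (f : A → B → C) xs ys →
  length (cartesianProductWith f xs ys) ≡ length xs * length ys
length-cartesianProductWith f [] ys = refl
length-cartesianProductWith f (x ∷ xs) ys = begin
  length (map (f x) ys ++ cartesianProductWith f xs ys)          ≡⟨ LP.length-++ (map (f x) ys) ⟩
  length (map (f x) ys) + length (cartesianProductWith f xs ys)  ≡⟨ cong₂ _+_ (LP.length-map (f x) ys)
                                                                          (length-cartesianProductWith f xs ys) ⟩
  length ys + length xs * length ys                              ∎
  where open ≡-Reasoning

length-tuples : ∀ σ k → length (tuples σ k) ≡ σ ^ k
length-tuples σ zero = refl
length-tuples σ (suc k) = trans (length-cartesianProductWith _∷_ (allFin σ) (tuples σ k))
                                (cong₂ _*_ (LP.length-tabulate {n = σ} (λ x → x)) (length-tuples σ k))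

∈-length≡1⇒≡ : ∀ {A : Set} {xs : List A} {x y : A} → length xs ≡ 1 → x ∈ xs → y ∈ xs → x ≡ y
∈-length≡1⇒≡ {xs = _ ∷ []} _ (here refl) (here refl) = refl

Constant : ∀ {A : Set} → List A → Set
Constant xs = ∀ {x y} → x ∈ xs → y ∈ xs → x ≡ y

slice : ∀ {A : Set} → (ℕ → A) → ℕ → ℕ → List A
slice f i zero = []
slice f i (suc r) = f i ∷ slice f (suc i) r

module _ {A : Set} (f : ℕ → A) where

  slice-++ : ∀ i a b → slice f i (a + b) ≡ slice f i a ++ slice f (i + a) b
  slice-++ i zero b = cong (λ j → slice f j b) (sym (+-identityʳ i))
  slice-++ i (suc a) b = cong (f i ∷_) (trans (slice-++ (suc i) a b)
                                              (cong (λ j → slice f (suc i) a ++ slice f j b) (sym (+-suc i a))))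

  slice-periodic : ∀ {N} → (∀ j → f (j + N) ≡ f j) → ∀ i r → slice f (i + N) r ≡ slice f i r
  slice-periodic per i zero = refl
  slice-periodic per i (suc r) = cong₂ _∷_ (per i) (slice-periodic per (suc i) r)

  drop-slice : ∀ i r p → drop p (slice f i r) ≡ slice f (i + p) (r ∸ p)
  drop-slice i r zero = cong (λ j → slice f j r) (sym (+-identityʳ i))
  drop-slice i zero (suc p) = refl
  drop-slice i (suc r) (suc p) = trans (drop-slice (suc i) r p) (cong (λ j → slice f j (r ∸ p)) (sym (+-suc i p)))

  drop-slice≡∷ : ∀ i r k {b ys} → drop k (slice f i r) ≡ b ∷ ys →
    b ≡ f (i + k) × take k (slice f i r) ≡ slice f i k
  drop-slice≡∷ i (suc r) zero refl = cong f (sym (+-identityʳ i)) , refl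
  drop-slice≡∷ i (suc r) (suc k) eq with drop-slice≡∷ (suc i) r k eq
  ... | b≡ , take≡ = trans b≡ (cong f (sym (+-suc i k))) , cong (f i ∷_) take≡

  tabulate≡slice : ∀ {n} (h : Fin n → A) i → (∀ x → h x ≡ f (i + toℕ x)) → tabulate h ≡ slice f i n
  tabulate≡slice {zero} h i h≗ = refl
  tabulate≡slice {suc n} h i h≗ = cong₂ _∷_ (trans (h≗ Fin.zero) (cong f (+-identityʳ i)))
    (tabulate≡slice (λ x → h (Fin.suc x)) (suc i) (λ x → trans (h≗ (Fin.suc x)) (cong f (+-suc i (toℕ x)))))

  slice-≡⇒≡ : ∀ p q {k} → slice f p k ≡ slice f q k →
    ∀ (j : Fin k) → f (p + toℕ j) ≡ f (q + toℕ j)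
  slice-≡⇒≡ p q {suc k} eq Fin.zero =
    trans (cong f (+-identityʳ p)) (trans (LP.∷-injectiveˡ eq) (cong f (sym (+-identityʳ q))))
  slice-≡⇒≡ p q {suc k} eq (Fin.suc j) =
    trans (cong f (+-suc p (toℕ j))) (trans (slice-≡⇒≡ (suc p) (suc q) (LP.∷-injectiveʳ eq) j)
                                            (cong f (sym (+-suc q (toℕ j)))))

∈-ctx⇒occurrence : ∀ {σ} k (w xs : Str σ) {b} → b ∈ ctx k w xs →
  ∃ λ p → ∃ λ ys → take k (drop p xs) ≡ w × drop k (drop p xs) ≡ b ∷ ys
∈-ctx⇒occurrence k w (a ∷ xs) b∈ with drop k (a ∷ xs) in drop≡
... | [] with ∈-ctx⇒occurrence k w xs b∈
...   | p , ys , occ = suc p , ys , occ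
∈-ctx⇒occurrence k w (a ∷ xs) b∈ | c ∷ zs with LP.≡-dec Fin._≟_ (take k (a ∷ xs)) w
∈-ctx⇒occurrence k w (a ∷ xs) (here refl) | c ∷ zs | yes take≡ = 0 , zs , take≡ , drop≡
∈-ctx⇒occurrence k w (a ∷ xs) (there b∈) | c ∷ zs | yes _ with ∈-ctx⇒occurrence k w xs b∈
...   | p , ys , occ = suc p , ys , occ
∈-ctx⇒occurrence k w (a ∷ xs) b∈ | c ∷ zs | no _ with ∈-ctx⇒occurrence k w xs b∈
...   | p , ys , occ = suc p , ys , occ

length-ctx≤ : ∀ {σ} k (w xs : Str σ) → length (ctx k w xs) ≤ length xs
length-ctx≤ k w [] = z≤n
length-ctx≤ k w (a ∷ xs) with drop k (a ∷ xs)
... | [] = m≤n⇒m≤1+n (length-ctx≤ k w xs)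
... | c ∷ _ with LP.≡-dec Fin._≟_ (take k (a ∷ xs)) w
...   | yes _ = s≤s (length-ctx≤ k w xs)
...   | no _ = m≤n⇒m≤1+n (length-ctx≤ k w xs)

∈-ctx-slice⇒occurrence : ∀ {σ} (f : ℕ → Fin σ) k L w {b} → b ∈ ctx k w (slice f 0 L) →
  ∃ λ p → b ≡ f (p + k) × slice f p k ≡ w
∈-ctx-slice⇒occurrence f k L w b∈ with ∈-ctx⇒occurrence k w (slice f 0 L) b∈
... | p , ys , take≡ , drop≡
  with drop-slice≡∷ f p (L ∸ p) k (subst (λ xs → drop k xs ≡ _) (drop-slice f 0 L p) drop≡)
...   | b≡ , take-slice≡ = p , b≡ , trans (sym take-slice≡) (subst (λ xs → take k xs ≡ w) (drop-slice f 0 L p) take≡)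

ctx-slice-constant : ∀ {σ} (f : ℕ → Fin σ) k → (∀ p q → slice f p k ≡ slice f q k → f (p + k) ≡ f (q + k)) →
  ∀ L w → Constant (ctx k w (slice f 0 L))
ctx-slice-constant f k next L w b∈ b′∈
  with ∈-ctx-slice⇒occurrence f k L w b∈ | ∈-ctx-slice⇒occurrence f k L w b′∈
... | p , b≡ , wₚ | q , b′≡ , w_q = trans b≡ (trans (next p q (trans wₚ (sym w_q))) (sym b′≡))

module _ (N : ℕ) .{{_ : NonZero N}} where

  toℕ-mod : ∀ p → toℕ (p mod N) ≡ p % N
  toℕ-mod p = FP.toℕ-fromℕ< _

  %≡⇒mod≡ : ∀ {p q} → p % N ≡ q % N → p mod N ≡ q mod N
  %≡⇒mod≡ eq = FP.toℕ-injective (trans (toℕ-mod _) (trans eq (sym (toℕ-mod _))))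

  %-cong-+ʳ : ∀ {p q} j → p % N ≡ q % N → (p + j) % N ≡ (q + j) % N
  %-cong-+ʳ {p} {q} j eq = begin
    (p + j) % N          ≡⟨ %-distribˡ-+ p j N ⟩
    (p % N + j % N) % N  ≡⟨ cong (λ t → (t + j % N) % N) eq ⟩
    (q % N + j % N) % N  ≡⟨ %-distribˡ-+ q j N ⟨
    (q + j) % N          ∎
    where open ≡-Reasoning

module _ (σ k : ℕ) .{{_ : NonZero σ}} (d : Cyc σ k) where

  private
    N : ℕ
    N = σ ^ k
    instance
      N≢0 : NonZero N
      N≢0 = m^n≢0 σ k

  unroll : ℕ → Fin σ
  unroll j = d (j mod N)

  window-mod : ∀ p → window σ k d (p mod N) ≡ V.tabulate (λ j → unroll (p + toℕ j))
  window-mod p = VP.tabulate-cong λ j →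
    cong d (%≡⇒mod≡ N (%-cong-+ʳ N (toℕ j) (trans (cong (_% N) (toℕ-mod N p)) (m%n%n≡m%n p N))))

  window-injective : IsDeBruijn σ k d → ∀ i j → window σ k d i ≡ window σ k d j → i ≡ j
  window-injective db i j eq =
    ∈-length≡1⇒≡ (db (window σ k d i)) (∈-filter⁺ occurs? (∈-allFin i) refl) (∈-filter⁺ occurs? (∈-allFin j) (sym eq))
    where
    occurs? : ∀ i′ → Dec (window σ k d i′ ≡ window σ k d i)
    occurs? = λ i′ → VP.≡-dec Fin._≟_ (window σ k d i′) (window σ k d i)

  unroll-deterministic : IsDeBruijn σ k d →
    ∀ p q → slice unroll p k ≡ slice unroll q k → unroll (p + k) ≡ unroll (q + k)
  unroll-deterministic db p q eq = cong d (%≡⇒mod≡ N (%-cong-+ʳ N k p%N≡q%N))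
    where
    windows≡ : window σ k d (p mod N) ≡ window σ k d (q mod N)
    windows≡ = trans (window-mod p) (trans (VP.tabulate-cong (slice-≡⇒≡ unroll p q eq)) (sym (window-mod q)))
    p%N≡q%N : p % N ≡ q % N
    p%N≡q%N = trans (sym (toℕ-mod N p)) (trans (cong toℕ (window-injective db _ _ windows≡)) (toℕ-mod N q))

  star≡slice : ∀ m → concat (replicate m (linear σ k d)) ≡ slice unroll 0 (m * N)
  star≡slice zero = refl
  star≡slice (suc m) = begin
    linear σ k d ++ concat (replicate m (linear σ k d))  ≡⟨ cong₂ _++_ linear≡slice (star≡slice m) ⟩
    slice unroll 0 N ++ slice unroll 0 (m * N)          ≡⟨ cong (slice unroll 0 N ++_) (slice-periodic unroll periodic 0 (m * N)) ⟨
    slice unroll 0 N ++ slice unroll N (m * N)          ≡⟨ slice-++ unroll 0 N (m * N) ⟨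
    slice unroll 0 (N + m * N)                          ∎
    where
    open ≡-Reasoning
    linear≡slice : linear σ k d ≡ slice unroll 0 N
    linear≡slice = tabulate≡slice unroll d 0 λ x →
      cong d (FP.toℕ-injective (sym (trans (toℕ-mod N (toℕ x)) (m<n⇒m%n≡m (FP.toℕ<n x)))))
    periodic : ∀ j → unroll (j + N) ≡ unroll j
    periodic j = cong d (%≡⇒mod≡ N ([m+n]%n≡m%n j N))

constant-∷⇒All≡ : ∀ {A : Set} {a : A} {xs} → Constant (a ∷ xs) → All.All (_≡ a) xs
constant-∷⇒All≡ c = All.tabulate (λ b∈ → c (there b∈) (here refl))

H0*num-constant≤ : ∀ {σ} {x : Str σ} {n} → Constant x → length x ≤ n → 0 < n → H0*num x ≤ 2 * n
H0*num-constant≤ {x = []} {n} _ _ 0<n = ≤-trans 0<n (m≤m+n n (n + 0))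
H0*num-constant≤ {x = a ∷ xs} c len≤n _ with All.all? (λ b → b Fin.≟ a) xs
... | yes _ = *-monoʳ-≤ 2 (≤-trans (2^⌊log₂n⌋≤n (length (a ∷ xs)) (s≤s z≤n)) len≤n)
... | no ¬all = ⊥-elim (¬all (constant-∷⇒All≡ c))

H0*den-constant : ∀ {σ} {x : Str σ} → Constant x → H0*den x ≡ 1
H0*den-constant {x = []} _ = refl
H0*den-constant {x = a ∷ xs} c with All.all? (λ b → b Fin.≟ a) xs
... | yes _ = refl
... | no ¬all = ⊥-elim (¬all (constant-∷⇒All≡ c))

lemma3 : Σ ℕ λ c → Σ ℕ λ n₀ →
    (σ : ℕ) .{{_ : NonZero σ}} (k : ℕ) (d : Cyc σ k) → IsDeBruijn σ k d →
    (s : Str σ) → InStar s (linear σ k d) → n₀ ≤ length s →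
    Hk*num σ k s ≤ (length s ^ (c * σ ^ k)) * Hk*den σ k s
lemma3 = 2 , 2 , bound
  where
  bound : (σ : ℕ) .{{_ : NonZero σ}} (k : ℕ) (d : Cyc σ k) → IsDeBruijn σ k d →
    (s : Str σ) → InStar s (linear σ k d) → 2 ≤ length s →
    Hk*num σ k s ≤ (length s ^ (2 * σ ^ k)) * Hk*den σ k s
  bound σ k d db s (m , s≡) 2≤n = begin
    Hk*num σ k s                    ≤⟨ product-map-≤ _ (tuples σ k) H0*num≤n² ⟩
    (n ^ 2) ^ length (tuples σ k)   ≡⟨ cong ((n ^ 2) ^_) (length-tuples σ k) ⟩
    (n ^ 2) ^ σ ^ k                 ≡⟨ ^-*-assoc n 2 (σ ^ k) ⟩
    n ^ (2 * σ ^ k)                 ≡⟨ *-identityʳ _ ⟨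
    n ^ (2 * σ ^ k) * 1             ≡⟨ cong (n ^ (2 * σ ^ k) *_) Hk*den≡1 ⟨
    n ^ (2 * σ ^ k) * Hk*den σ k s  ∎
    where
    open ≤-Reasoning
    n : ℕ
    n = length s
    constant : ∀ w → Constant (ctx k w s)
    constant w = subst (λ t → Constant (ctx k w t)) (sym (trans s≡ (star≡slice σ k d m)))
      (ctx-slice-constant (unroll σ k d) k (unroll-deterministic σ k d db) (m * σ ^ k) w)
    H0*num≤n² : ∀ w → H0*num (ctx k w s) ≤ n ^ 2
    H0*num≤n² w = begin
      H0*num (ctx k w s)  ≤⟨ H0*num-constant≤ (constant w) (length-ctx≤ k w s) (≤-trans (s≤s z≤n) 2≤n) ⟩
      2 * n               ≤⟨ *-monoˡ-≤ n 2≤n ⟩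
      n * n               ≡⟨ cong (n *_) (*-identityʳ n) ⟨
      n ^ 2               ∎
    Hk*den≡1 : Hk*den σ k s ≡ 1
    Hk*den≡1 = product-map-≡1 _ (tuples σ k) (λ w → H0*den-constant (constant w))
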